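{- There exist two pp-interpretations $I_1,I_2$ of dimension $1$ of the structure $(\mathbb{Q};<)$ in the structure $(\mathbb{I};\mathsf{s},\mathsf{f})$, and a pp-interpretation $J$ of dimension $2$ of $(\mathbb{I};\mathsf{s},\mathsf{f})$ in $(\mathbb{Q};<)$, such that $J\circ(I_1,I_2)$ is pp-homotopic to the identity interpretation of $(\mathbb{I};\mathsf{s},\mathsf{f})$.
   Context: $\mathbb{I}$ is the set of closed intervals $[a,b]$ of rationals with $a<b$; for $X=[a,b]$ write $X^-=a$, $X^+=b$. The binary relations on $\mathbb{I}$ are: $X\,\mathsf{s}\,Y$ iff $X^-=Y^-$ and $X^+<Y^+$; $X\,\mathsf{f}\,Y$ iff $X^+=Y^+$ and $X^->Y^-$. A primitive positive (pp) formula uses only atomic formulas (relations and equality), conjunction and existential quantification; definability is parameter-free. A pp-interpretation of $\mathcal{B}$ in $\mathcal{A}$ is a triple $(k,\delta,g)$ with $\delta\subseteq A^k$ pp-definable in $\mathcal{A}$, $g:\delta\to B$ surjective, such that for every $s$-ary relation $S$ of $\mathcal{B}$ and for equality on $B$, $\{(\bar a_1,\ldots,\bar a_s)\in\delta^s:(g(\bar a_1),\ldots,g(\bar a_s))\in S\}$ is pp-definable in $\mathcal{A}$. For interpretations $I_\ell=(i,\delta_\ell,g_\ell)$ ($\ell=1,\ldots,j$) of $\mathcal{D}$ in $\mathcal{C}$ and $J=(j,\epsilon,h)$ of $\mathcal{C}$ in $\mathcal{D}$, $J\circ(I_1,\ldots,I_j)$ is the partial map $F:C^{ij}\rightharpoonup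 C$, $F(x_1,\ldots,x_{ij})=h(g_1(x_1,\ldots,x_i),\ldots,g_j(x_{ij-i+1},\ldots,x_{ij}))$, defined when each block lies in $\delta_\ell$ and the image tuple lies in $\epsilon$; it is pp-homotopic to the identity interpretation $(1,C,\mathrm{id})$ of $\mathcal{C}$ if $\{(y,x_1,\ldots,x_{ij}):F(x_1,\ldots,x_{ij})=y\}$ is pp-definable in $\mathcal{C}$. -}

module Defs where

open import Data.Nat using (ℕ; zero; suc; _*_)
open import Data.Fin using (Fin; zero; suc; combine)
open import Data.Product using (Σ; _×_; _,_)
open import Data.Rational using (ℚ; _<_)
open import Relation.Binary.PropositionalEquality using (_≡_)
open import Data.Vec.Functional using (_∷_; head; tail)

record Structure : Set₁ where
  field
    Carrier : Set
    nrel    : ℕ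
    arity   : Fin nrel → ℕ
    rel     : (r : Fin nrel) → (Fin (arity r) → Carrier) → Set

open Structure public

data PP (𝔄 : Structure) : ℕ → Set where
  atom : ∀ {n} (r : Fin (nrel 𝔄)) → (Fin (arity 𝔄 r) → Fin n) → PP 𝔄 n
  eq   : ∀ {n} → Fin n → Fin n → PP 𝔄 n
  _∧_  : ∀ {n} → PP 𝔄 n → PP 𝔄 n → PP 𝔄 n
  ex   : ∀ {n} → PP 𝔄 (suc n) → PP 𝔄 n   -- binds variable zero

⟦_⟧ : ∀ {𝔄 : Structure} {n} → PP 𝔄 n → (Fin n → Carrier 𝔄) → Set
⟦_⟧ {𝔄} (atom r ι) v = rel 𝔄 r (λ i → v (ι i))
⟦ eq i j ⟧ v = v i ≡ v j
⟦ φ ∧ ψ ⟧ v = ⟦ φ ⟧ v × ⟦ ψ ⟧ v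
⟦_⟧ {𝔄} (ex φ) v = Σ (Carrier 𝔄) (λ a → ⟦ φ ⟧ (a ∷ v))

PPDefinable : (𝔄 : Structure) (n : ℕ) → ((Fin n → Carrier 𝔄) → Set) → Set
PPDefinable 𝔄 n P =
  Σ (PP 𝔄 n) (λ φ → ∀ v → (P v → ⟦ φ ⟧ v) × (⟦ φ ⟧ v → P v))

block : ∀ {A : Set} s {k} → (Fin (s * k) → A) → Fin s → Fin k → A
block s x i j = x (combine i j)

-- pp-interpretation (k, δ, g) of 𝔅 in 𝔄.  g is given as a function on
-- A^k whose values outside δ are irrelevant (only used on δ).

record Interpretation (𝔅 𝔄 : Structure) (k : ℕ) : Set₁ where
  field
    dom     : (Fin k → Carrier 𝔄) → Set
    dom-def : PPDefinable 𝔄 k dom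
    map     : (Fin k → Carrier 𝔄) → Carrier 𝔅
    surj    : ∀ b → Σ (Fin k → Carrier 𝔄) (λ x → dom x × map x ≡ b)
    rel-def : ∀ r → PPDefinable 𝔄 (arity 𝔅 r * k)
                (λ x → (∀ i → dom (block (arity 𝔅 r) x i))
                     × rel 𝔅 r (λ i → map (block (arity 𝔅 r) x i)))
    eq-def  : PPDefinable 𝔄 (2 * k)
                (λ x → (∀ i → dom (block 2 x i))
                     × map (block 2 x zero) ≡ map (block 2 x (suc zero)))

open Interpretation public

-- J ∘ (I_1,…,I_j) is pp-homotopic to the identity interpretation of ℭ:
-- {(y, x_1,…,x_ij) : F(x_1,…,x_ij) = y} is pp-definable in ℭ.

Homotopic : ∀ {ℭ 𝔇 : Structure} {i j : ℕ}
  → (Fin j → Interpretation 𝔇 ℭ i) → Interpretation ℭ 𝔇 j → Set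
Homotopic {ℭ} {𝔇} {i} {j} Is J =
  PPDefinable ℭ (suc (j * i)) (λ z →
    (∀ l → dom (Is l) (block j (tail z) l))
    × dom J (λ l → map (Is l) (block j (tail z) l))
    × map J (λ l → map (Is l) (block j (tail z) l)) ≡ head z)

ℚ< : Structure
ℚ< = record
  { Carrier = ℚ ; nrel = 1 ; arity = λ _ → 2
  ; rel = λ _ v → v zero < v (suc zero) }

record 𝕀 : Set where
  constructor [_,_]⟨_⟩
  field
    lo  : ℚ
    hi  : ℚ
    .lo<hi : lo < hi

open 𝕀 public

_s_ : 𝕀 → 𝕀 → Set
X s Y = (lo X ≡ lo Y) × (hi X < hi Y)

_f_ : 𝕀 → 𝕀 → Set
X f Y = (hi X ≡ hi Y) × (lo Y < lo X)

𝕀sf-rel : (r : Fin 2) → (Fin 2 → 𝕀) → Set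
𝕀sf-rel zero v = v zero s v (suc zero)
𝕀sf-rel (suc _) v = v zero f v (suc zero)

𝕀sf : Structure
𝕀sf = record { Carrier = 𝕀 ; nrel = 2 ; arity = λ _ → 2 ; rel = 𝕀sf-rel }

-- Equality and order of endpoints are pp-definable from s and f: X⁻ = Y⁻ iff
-- X and Y have a common s-predecessor (by density of ℚ), and X⁻ < Y⁻ iff Y
-- finishes some U with U⁻ = X⁻ (take U = [X⁻, Y⁺]); dually for X⁺.  Hence
-- X ↦ X⁻ and X ↦ X⁺ interpret (ℚ;<) in (𝕀;s,f), while pairs a < b interpret
-- (𝕀;s,f) in (ℚ;<).  The composite sends (X, Y) to [X⁻, Y⁺], and Z = [X⁻, Y⁺]
-- says exactly that Z shares its left endpoint with X and its right one with Y.
module Submission where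

open import Defs
open import Data.Product using (Σ)
open import Data.Vec.Functional using (_∷_; [])

open import Data.Nat using (ℕ)
open import Data.Fin using (Fin; zero; suc; #_)
open import Data.Product using (_×_; _,_; proj₁; proj₂; ∃-syntax)
open import Data.Sum using (inj₁; inj₂)
open import Data.Unit using (⊤; tt)
open import Data.Empty using (⊥-elim)
open import Data.Rational using (ℚ; _<_; _+_; _-_; -_; _⊓_; _⊔_; 0ℚ; 1ℚ)
open import Data.Rational.Properties
  using (_<?_; <-trans; <-≤-trans; ≤-<-trans; <-dense; ⊓-sel; ⊔-sel; p⊓q≤p; p⊓q≤q;
         p≤p⊔q; p≤q⊔p; +-monoʳ-<; +-identityʳ; positive⁻¹; negative⁻¹)
open import Function using (id)
open import Function.Bundles using (_⇔_; mk⇔; Equivalence)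
open import Relation.Nullary using (yes; no)
open import Relation.Nullary.Decidable using (recompute)
open import Relation.Binary.PropositionalEquality using (_≡_; refl; sym; subst; subst₂)

open Equivalence using (to; from)

ppDefinable : ∀ {𝔄 : Structure} {n} {P : (Fin n → Carrier 𝔄) → Set}
  (φ : PP 𝔄 n) → (∀ v → P v ⇔ ⟦ φ ⟧ v) → PPDefinable 𝔄 n P
ppDefinable φ P⇔φ = φ , λ v → to (P⇔φ v) , from (P⇔φ v)

no-max : ∀ q → ∃[ r ] q < r
no-max q = q + 1ℚ , subst (_< q + 1ℚ) (+-identityʳ q) (+-monoʳ-< q (positive⁻¹ 1ℚ))

no-min : ∀ q → ∃[ r ] r < q
no-min q = q - 1ℚ , subst (q - 1ℚ <_) (+-identityʳ q) (+-monoʳ-< q (negative⁻¹ (- 1ℚ)))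

lo<hi′ : (X : 𝕀) → lo X < hi X
lo<hi′ [ a , b ]⟨ a<b ⟩ = recompute (a <? b) a<b

-- The junk value [0,1] for a ≮ b is never observed: J only decodes ordered pairs.
interval : ℚ → ℚ → 𝕀
interval a b with a <? b
... | yes a<b = [ a , b ]⟨ a<b ⟩
... | no _    = [ 0ℚ , 1ℚ ]⟨ positive⁻¹ 1ℚ ⟩

interval-< : ∀ {a b} (a<b : a < b) → interval a b ≡ [ a , b ]⟨ a<b ⟩
interval-< {a} {b} a<b with a <? b
... | yes _   = refl
... | no a≮b = ⊥-elim (a≮b a<b)

interval-η : (X : 𝕀) → interval (lo X) (hi X) ≡ X
interval-η X = interval-< (lo<hi′ X)

module _ {a b : ℚ} (a<b : a < b) where

  interval≡⇔endpoints≡ : ∀ X → interval a b ≡ X ⇔ (lo X ≡ a × hi X ≡ b)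
  interval≡⇔endpoints≡ X rewrite interval-< a<b = mk⇔ (λ { refl → refl , refl }) (λ { (refl , refl) → refl })

  module _ {c d : ℚ} (c<d : c < d) where

    interval-≡⇔ : interval a b ≡ interval c d ⇔ (a ≡ c × b ≡ d)
    interval-≡⇔ rewrite interval-< a<b | interval-< c<d =
      mk⇔ (λ { refl → refl , refl }) (λ { (refl , refl) → refl })

    interval-s⇔ : interval a b s interval c d ⇔ (a ≡ c × b < d)
    interval-s⇔ rewrite interval-< a<b | interval-< c<d = mk⇔ id id

    interval-f⇔ : interval a b f interval c d ⇔ (b ≡ d × c < a)
    interval-f⇔ rewrite interval-< a<b | interval-< c<d = mk⇔ id id

common-starter : ∀ {X Y} → lo X ≡ lo Y → ∃[ Z ] Z s X × Z s Y
common-starter {X} {Y} lo≡ with <-dense lo<hi⊓hi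
  where
  lo<hi⊓hi : lo X < hi X ⊓ hi Y
  lo<hi⊓hi with ⊓-sel (hi X) (hi Y)
  ... | inj₁ ⊓≡hiX = subst (lo X <_) (sym ⊓≡hiX) (lo<hi′ X)
  ... | inj₂ ⊓≡hiY = subst₂ _<_ (sym lo≡) (sym ⊓≡hiY) (lo<hi′ Y)
... | m , lo<m , m<⊓ =
  [ lo X , m ]⟨ lo<m ⟩ , (refl , <-≤-trans m<⊓ (p⊓q≤p (hi X) (hi Y)))
                       , (lo≡ , <-≤-trans m<⊓ (p⊓q≤q (hi X) (hi Y)))

common-finisher : ∀ {X Y} → hi X ≡ hi Y → ∃[ Z ] Z f X × Z f Y
common-finisher {X} {Y} hi≡ with <-dense lo⊔lo<hi
  where
  lo⊔lo<hi : lo X ⊔ lo Y < hi X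
  lo⊔lo<hi with ⊔-sel (lo X) (lo Y)
  ... | inj₁ ⊔≡loX = subst (_< hi X) (sym ⊔≡loX) (lo<hi′ X)
  ... | inj₂ ⊔≡loY = subst₂ _<_ (sym ⊔≡loY) (sym hi≡) (lo<hi′ Y)
... | m , ⊔<m , m<hi =
  [ m , hi X ]⟨ m<hi ⟩ , (refl , ≤-<-trans (p≤p⊔q (lo X) (lo Y)) ⊔<m)
                       , (hi≡ , ≤-<-trans (p≤q⊔p (lo X) (lo Y)) ⊔<m)

infix 30 _s′_ _f′_
_s′_ _f′_ : ∀ {n} → Fin n → Fin n → PP 𝕀sf n
a s′ b = atom zero (a ∷ b ∷ [])
a f′ b = atom (suc zero) (a ∷ b ∷ [])

sameLo sameHi loLess hiLess : ∀ {n} → Fin n → Fin n → PP 𝕀sf n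
sameLo a b = ex (zero s′ suc a ∧ zero s′ suc b)
sameHi a b = ex (zero f′ suc a ∧ zero f′ suc b)
loLess a b = ex (sameLo zero (suc a) ∧ suc b f′ zero)
hiLess a b = ex (sameHi zero (suc b) ∧ suc a s′ zero)

module _ {n : ℕ} (v : Fin n → 𝕀) (a b : Fin n) where

  sameLo-correct : lo (v a) ≡ lo (v b) ⇔ ⟦ sameLo a b ⟧ v
  sameLo-correct = mk⇔ (common-starter {v a} {v b}) λ { (_ , (e₁ , _) , (e₂ , _)) → subst₂ _≡_ e₁ e₂ refl }

  sameHi-correct : hi (v a) ≡ hi (v b) ⇔ ⟦ sameHi a b ⟧ v
  sameHi-correct = mk⇔ (common-finisher {v a} {v b}) λ { (_ , (e₁ , _) , (e₂ , _)) → subst₂ _≡_ e₁ e₂ refl }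

module _ {n : ℕ} (v : Fin n → 𝕀) (a b : Fin n) where

  loLess-correct : lo (v a) < lo (v b) ⇔ ⟦ loLess a b ⟧ v
  loLess-correct = mk⇔
    (λ lo< → let U = [ lo (v a) , hi (v b) ]⟨ <-trans lo< (lo<hi′ (v b)) ⟩
             in U , to (sameLo-correct (U ∷ v) zero (suc a)) refl , refl , lo<)
    λ { (U , U≈a , _ , lo<) → subst (_< lo (v b)) (from (sameLo-correct (U ∷ v) zero (suc a)) U≈a) lo< }

  hiLess-correct : hi (v a) < hi (v b) ⇔ ⟦ hiLess a b ⟧ v
  hiLess-correct = mk⇔
    (λ hi< → let U = [ lo (v a) , hi (v b) ]⟨ <-trans (lo<hi′ (v a)) hi< ⟩
             in U , to (sameHi-correct (U ∷ v) zero (suc b)) refl , refl , hi<)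
    λ { (U , U≈b , _ , hi<) → subst (hi (v a) <_) (from (sameHi-correct (U ∷ v) zero (suc b)) U≈b) hi< }

fullDomainInterpretation : (𝔄 : Structure) (π : Carrier 𝔄 → ℚ)
  → (∀ q → ∃[ x ] π x ≡ q)
  → PPDefinable 𝔄 2 (λ v → π (v zero) < π (v (suc zero)))
  → PPDefinable 𝔄 2 (λ v → π (v zero) ≡ π (v (suc zero)))
  → Interpretation ℚ< 𝔄 1
fullDomainInterpretation 𝔄 π π-surj (φ< , φ<-correct) (φ≡ , φ≡-correct) = record
  { dom     = λ _ → ⊤
  ; dom-def = eq zero zero , λ _ → (λ _ → refl) , (λ _ → tt)
  ; map     = λ v → π (v zero)
  ; surj    = λ q → let x , πx≡q = π-surj q in (λ _ → x) , tt , πx≡q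
  ; rel-def = λ _ → φ< , λ v → (λ (_ , π<) → proj₁ (φ<-correct v) π<)
                             , (λ φv → (λ _ → tt) , proj₂ (φ<-correct v) φv)
  ; eq-def  = φ≡ , λ v → (λ (_ , π≡) → proj₁ (φ≡-correct v) π≡)
                       , (λ φv → (λ _ → tt) , proj₂ (φ≡-correct v) φv)
  }

I₁ I₂ : Interpretation ℚ< 𝕀sf 1
I₁ = fullDomainInterpretation 𝕀sf lo
  (λ q → let r , q<r = no-max q in [ q , r ]⟨ q<r ⟩ , refl)
  (ppDefinable (loLess zero (suc zero)) λ v → loLess-correct v zero (suc zero))
  (ppDefinable (sameLo zero (suc zero)) λ v → sameLo-correct v zero (suc zero))
I₂ = fullDomainInterpretation 𝕀sf hi
  (λ q → let r , r<q = no-min q in [ r , q ]⟨ r<q ⟩ , refl)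
  (ppDefinable (hiLess zero (suc zero)) λ v → hiLess-correct v zero (suc zero))
  (ppDefinable (sameHi zero (suc zero)) λ v → sameHi-correct v zero (suc zero))

infix 30 _<′_
_<′_ : ∀ {n} → Fin n → Fin n → PP ℚ< n
a <′ b = atom zero (a ∷ b ∷ [])

Ordered : (Fin 2 → ℚ) → Set
Ordered x = x zero < x (suc zero)

toInterval : (Fin 2 → ℚ) → 𝕀
toInterval x = interval (x zero) (x (suc zero))

intervalRelation-definable : (R : 𝕀 → 𝕀 → Set) (ψ : PP ℚ< 4)
  → (∀ x → x (# 0) < x (# 1) → x (# 2) < x (# 3)
         → R (interval (x (# 0)) (x (# 1))) (interval (x (# 2)) (x (# 3))) ⇔ ⟦ ψ ⟧ x)
  → PPDefinable ℚ< 4 (λ x → (∀ i → Ordered (block 2 x i))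
                           × R (toInterval (block 2 x zero)) (toInterval (block 2 x (suc zero))))
intervalRelation-definable R ψ R⇔ψ = ppDefinable (((# 0) <′ (# 1) ∧ (# 2) <′ (# 3)) ∧ ψ) λ x → mk⇔
  (λ (ordered , Rx) → (ordered zero , ordered (suc zero))
                    , to (R⇔ψ x (ordered zero) (ordered (suc zero))) Rx)
  λ ((x₀<x₁ , x₂<x₃) , ψx) → (λ { zero → x₀<x₁ ; (suc zero) → x₂<x₃ }) , from (R⇔ψ x x₀<x₁ x₂<x₃) ψx

J : Interpretation 𝕀sf ℚ< 2
J = record
  { dom     = Ordered
  ; dom-def = ppDefinable (zero <′ suc zero) λ _ → mk⇔ id id
  ; map     = toInterval
  ; surj    = λ X → (lo X ∷ hi X ∷ []) , lo<hi′ X , interval-η X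
  ; rel-def = λ
      { zero       → intervalRelation-definable _s_ (eq (# 0) (# 2) ∧ (# 1) <′ (# 3)) λ _ p q → interval-s⇔ p q
      ; (suc zero) → intervalRelation-definable _f_ (eq (# 1) (# 3) ∧ (# 2) <′ (# 0)) λ _ p q → interval-f⇔ p q
      }
  ; eq-def  = intervalRelation-definable _≡_ (eq (# 0) (# 2) ∧ eq (# 1) (# 3)) λ _ p q → interval-≡⇔ p q
  }

J∘I-homotopic : Homotopic (I₁ ∷ I₂ ∷ []) J
J∘I-homotopic = ppDefinable (sameLo (# 0) (# 1) ∧ sameHi (# 0) (# 2)) λ z → mk⇔
  (λ { (_ , lo<hi , interval≡z₀) →
     let lo≡ , hi≡ = to (interval≡⇔endpoints≡ lo<hi (z (# 0))) interval≡z₀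
     in to (sameLo-correct z (# 0) (# 1)) lo≡ , to (sameHi-correct z (# 0) (# 2)) hi≡ })
  λ { (≈lo , ≈hi) →
     let lo≡ = from (sameLo-correct z (# 0) (# 1)) ≈lo
         hi≡ = from (sameHi-correct z (# 0) (# 2)) ≈hi
         lo<hi = subst₂ _<_ lo≡ hi≡ (lo<hi′ (z (# 0)))
     in (λ { zero → tt ; (suc zero) → tt }) , lo<hi , from (interval≡⇔endpoints≡ lo<hi (z (# 0))) (lo≡ , hi≡) }

lemma3 : Σ (Interpretation ℚ< 𝕀sf 1) (λ I₁ →
    Σ (Interpretation ℚ< 𝕀sf 1) (λ I₂ →
    Σ (Interpretation 𝕀sf ℚ< 2) (λ J →
    Homotopic (I₁ ∷ I₂ ∷ []) J)))
lemma3 = I₁ , I₂ , J , J∘I-homotopic
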